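{- For each positive integer $n$ there exists a finite value $g(n)$ such that for every integer $k\geq g(n)$, every $k$-latin square of order $n$ is separable.
   Context: For a positive integer $a$, $N(a)=\{1,\dots,a\}$. A $k$-latin square of order $n$ is an $n\times n$ array $L$ whose cell $(i,j)$ contains a multiset $L(i,j)$ of exactly $k$ elements of $N(n)$, such that each symbol of $N(n)$ occurs exactly $k$ times (counting multiplicity) in each row and exactly $k$ times in each column. If $L_1$ is a $k_1$-latin square and $L_2$ a $k_2$-latin square, both of order $n$, their join is the $(k_1+k_2)$-latin square with cells $L_1(i,j)\cup L_2(i,j)$ (multiset union, adding multiplicities). A $k$-latin square $L$ is separable if there exist positive integers $k_1,k_2<k$ with $k_1+k_2=k$ such that $L$ is the join of a $k_1$-latin square and a $k_2$-latin square of order $n$. -}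

module Defs where

open import Data.Nat using (ℕ; zero; suc; _+_; _<_; _≥_)
open import Data.Fin using (Fin; zero; suc)
open import Data.Product using (Σ; _×_; ∃)
open import Relation.Binary.PropositionalEquality using (_≡_)

sumFin : (n : ℕ) → (Fin n → ℕ) → ℕ
sumFin zero    f = 0
sumFin (suc n) f = f zero + sumFin n (λ i → f (suc i))

-- An n×n array whose cells are multisets of symbols from N(n) = Fin n.
-- A multiset on Fin n is represented by its multiplicity function Fin n → ℕ.
-- A i j s = multiplicity of symbol s in cell (i , j).
Array : ℕ → Set
Array n = Fin n → Fin n → Fin n → ℕ

record IsKLatin (n k : ℕ) (L : Array n) : Set where
  field
    cell-size : ∀ i j → sumFin n (λ s → L i j s) ≡ k
    row-count : ∀ i s → sumFin n (λ j → L i j s) ≡ k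
    col-count : ∀ j s → sumFin n (λ i → L i j s) ≡ k

join : {n : ℕ} → Array n → Array n → Array n
join L₁ L₂ i j s = L₁ i j s + L₂ i j s

Separable : (n k : ℕ) → Array n → Set
Separable n k L =
  Σ ℕ λ k₁ → Σ ℕ λ k₂ → Σ (Array n) λ L₁ → Σ (Array n) λ L₂ →
    (0 < k₁) × (0 < k₂) × (k₁ + k₂ ≡ k) ×
    IsKLatin n k₁ L₁ × IsKLatin n k₂ L₂ ×
    (∀ i j s → L i j s ≡ join L₁ L₂ i j s)

module Submission where

-- (1) A zero-sum splitting theorem for integer vectors ('splittable'): for
--     every dimension d and bound a there is a threshold G such that every
--     list of at least G vectors in ℤ^d with entries in [-a, a] and total sum
--     zero splits into two nonempty sublists, each of sum zero.  The proof is
--     by induction on d and, inside, on the bound of the first coordinate: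
--     if that coordinate is bounded by a+1, the list can be grouped into
--     blocks of one or two elements whose first coordinate is bounded by a
--     ('halving'), with at least half as many blocks as elements; splitting
--     the list of blocks splits the original list.
--
-- (2) An encoding of arrays as lists of entries (row, column, symbol).  A
--     list is 'Balanced' with value m if each of the 3n² lines (row/symbol,
--     column/symbol and cell) meets it exactly m times; balanced lists are
--     exactly the m-latin squares.  Balancedness is the vanishing of the
--     integer vectors "meets line ℓ minus meets a fixed line ℓ₀", so a
--     zero-sum split of the entry list of a k-latin square L is a splitting
--     of L into an m-latin and a (k-m)-latin square.  Since the entry list has
--     length at least k, the threshold of (1) is the required bound g(n).

open import Defs
open import Data.Nat using (ℕ; _<_; _≥_)
open import Data.Product using (Σ)

open import Data.Nat using (zero; suc; _+_; _*_; _∸_; _≤_; z≤n; s≤s)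
import Data.Nat.Properties as NP
open import Data.Nat.ListAction using (sum)
open import Data.Nat.ListAction.Properties using (sum-++; sum-↭)
open import Data.Integer as ℤ using (ℤ; +_; -[1+_]; +[1+_]; 0ℤ; ∣_∣; -_; _-_)
  renaming (_+_ to _+ℤ_; _≤_ to _≤ℤ_; _<_ to _<ℤ_)
import Data.Integer.Properties as ZP
open import Data.Fin using (Fin; combine; remQuot) renaming (zero to fz; suc to fs)
open import Data.Fin.Properties using (remQuot-combine)
open import Data.Product using (_×_; _,_; proj₁; proj₂)
open import Data.Sum using (_⊎_; inj₁; inj₂)
open import Data.List using (List; []; _∷_; _++_; length; map; concat; tabulate; replicate)
open import Data.List.Properties using (map-++; ++-assoc; length-map)
open import Data.List.Relation.Unary.All as All using (All; []; _∷_)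
open import Data.List.Relation.Binary.Permutation.Propositional
  using (_↭_; ↭-refl; ↭-sym; ↭-trans; ↭-reflexive; prep; swap)
import Data.List.Relation.Binary.Permutation.Propositional.Properties as PermP
open import Relation.Binary.PropositionalEquality
open import Relation.Nullary using (¬_; yes; no; Dec)
open import Data.Empty using (⊥-elim)
import Algebra.Properties.CommutativeSemigroup as CSP

private
  variable
    X : Set

sumℤ : (X → ℤ) → List X → ℤ
sumℤ f []       = 0ℤ
sumℤ f (x ∷ xs) = f x +ℤ sumℤ f xs

sumℤ-++ : (f : X → ℤ) (xs ys : List X) → sumℤ f (xs ++ ys) ≡ sumℤ f xs +ℤ sumℤ f ys
sumℤ-++ f []       ys = sym (ZP.+-identityˡ _)
sumℤ-++ f (x ∷ xs) ys = trans (cong (f x +ℤ_) (sumℤ-++ f xs ys)) (sym (ZP.+-assoc (f x) _ _))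

sumℤ-↭ : (f : X → ℤ) {xs ys : List X} → xs ↭ ys → sumℤ f xs ≡ sumℤ f ys
sumℤ-↭ f _↭_.refl = refl
sumℤ-↭ f (prep x p) = cong (f x +ℤ_) (sumℤ-↭ f p)
sumℤ-↭ f (swap {xs} {ys} x y p) = begin
  f x +ℤ (f y +ℤ sumℤ f xs)  ≡⟨ sym (ZP.+-assoc (f x) (f y) _) ⟩
  (f x +ℤ f y) +ℤ sumℤ f xs  ≡⟨ cong₂ _+ℤ_ (ZP.+-comm (f x) (f y)) (sumℤ-↭ f p) ⟩
  (f y +ℤ f x) +ℤ sumℤ f ys  ≡⟨ ZP.+-assoc (f y) (f x) _ ⟩
  f y +ℤ (f x +ℤ sumℤ f ys)  ∎
  where open ≡-Reasoning
sumℤ-↭ f (_↭_.trans p q) = trans (sumℤ-↭ f p) (sumℤ-↭ f q)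

sumℤ-neg : (f : X → ℤ) (xs : List X) → sumℤ (λ x → - f x) xs ≡ - sumℤ f xs
sumℤ-neg f []       = refl
sumℤ-neg f (x ∷ xs) = trans (cong (- f x +ℤ_) (sumℤ-neg f xs)) (sym (ZP.neg-distrib-+ (f x) _))

sumℤ-nonneg : (f : X → ℤ) (xs : List X) → All (λ x → 0ℤ ≤ℤ f x) xs → 0ℤ ≤ℤ sumℤ f xs
sumℤ-nonneg f []       []       = ZP.≤-refl
sumℤ-nonneg f (x ∷ xs) (p ∷ ps) = ZP.+-mono-≤ p (sumℤ-nonneg f xs ps)

sumℤ-zero : (f : X → ℤ) (xs : List X) → (∀ x → f x ≡ 0ℤ) → sumℤ f xs ≡ 0ℤ
sumℤ-zero f []       h = refl
sumℤ-zero f (x ∷ xs) h = cong₂ _+ℤ_ (h x) (sumℤ-zero f xs h)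

extract : {P : X → Set} → (∀ x → Dec (P x)) → (xs : List X) →
  (Σ X λ z → Σ (List X) λ r → P z × (xs ↭ z ∷ r)) ⊎ All (λ x → ¬ P x) xs
extract d [] = inj₂ []
extract d (x ∷ xs) with d x
... | yes p = inj₁ (x , xs , p , ↭-refl)
... | no ¬p with extract d xs
...   | inj₂ none = inj₂ (¬p ∷ none)
...   | inj₁ (z , r , pz , q) = inj₁ (z , x ∷ r , pz , ↭-trans (prep x q) (swap x z ↭-refl))

Block : Set → Set
Block X = X ⊎ (X × X)

members : Block X → List X
members (inj₁ x)       = x ∷ []
members (inj₂ (x , y)) = x ∷ y ∷ []

blockSum : (X → ℤ) → Block X → ℤ
blockSum f (inj₁ x)       = f x
blockSum f (inj₂ (x , y)) = f x +ℤ f y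

sumℤ-members : (f : X → ℤ) (b : Block X) → sumℤ f (members b) ≡ blockSum f b
sumℤ-members f (inj₁ x)       = ZP.+-identityʳ (f x)
sumℤ-members f (inj₂ (x , y)) = cong (f x +ℤ_) (ZP.+-identityʳ (f y))

unblock : {Q : Block X → Set} → List (Σ (Block X) Q) → List X
unblock []             = []
unblock ((b , _) ∷ bs) = members b ++ unblock bs

sumℤ-unblock : {Q : Block X → Set} (f : X → ℤ) (bs : List (Σ (Block X) Q)) →
  sumℤ f (unblock bs) ≡ sumℤ (λ p → blockSum f (proj₁ p)) bs
sumℤ-unblock f []             = refl
sumℤ-unblock f ((b , _) ∷ bs) =
  trans (sumℤ-++ f (members b) (unblock bs)) (cong₂ _+ℤ_ (sumℤ-members f b) (sumℤ-unblock f bs))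

unblock-++ : {Q : Block X → Set} (bs cs : List (Σ (Block X) Q)) →
  unblock (bs ++ cs) ≡ unblock bs ++ unblock cs
unblock-++ []             cs = refl
unblock-++ ((b , _) ∷ bs) cs =
  trans (cong (members b ++_) (unblock-++ bs cs)) (sym (++-assoc (members b) _ _))

unblock-↭ : {Q : Block X → Set} {bs cs : List (Σ (Block X) Q)} → bs ↭ cs → unblock bs ↭ unblock cs
unblock-↭ _↭_.refl = ↭-refl
unblock-↭ (prep (b , _) p) = PermP.++⁺ˡ (members b) (unblock-↭ p)
unblock-↭ (swap {xs} {ys} (b , _) (c , _) p) =
  ↭-trans (↭-reflexive (sym (++-assoc (members b) (members c) (unblock xs))))
  (↭-trans (PermP.++⁺ (PermP.++-comm (members b) (members c)) (unblock-↭ p))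
           (↭-reflexive (++-assoc (members c) (members b) (unblock ys))))
unblock-↭ (_↭_.trans p q) = ↭-trans (unblock-↭ p) (unblock-↭ q)

unblock-map : {P Q : Block X → Set} (g : ∀ b → P b → Q b) (bs : List (Σ (Block X) P)) →
  unblock (map (λ p → proj₁ p , g (proj₁ p) (proj₂ p)) bs) ≡ unblock bs
unblock-map g []             = refl
unblock-map g ((b , _) ∷ bs) = cong (members b ++_) (unblock-map g bs)

length-unblock : {Q : Block X → Set} (bs : List (Σ (Block X) Q)) → length bs ≤ length (unblock bs)
length-unblock []                  = z≤n
length-unblock ((inj₁ _ , _) ∷ bs) = s≤s (length-unblock bs)
length-unblock ((inj₂ _ , _) ∷ bs) = s≤s (NP.m≤n⇒m≤1+n (length-unblock bs))

Grouping : (Block X → Set) → List X → Set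
Grouping {X} Q xs = Σ (List (Σ (Block X) Q)) λ bs →
  (unblock bs ↭ xs) × (length xs ≤ length bs + length bs)

grouping-↭ : {Q : Block X → Set} {xs ys : List X} → xs ↭ ys → Grouping Q ys → Grouping Q xs
grouping-↭ p (bs , u , l) = bs , ↭-trans u (↭-sym p) , subst (_≤ _) (sym (PermP.↭-length p)) l

grouping-mono : {P Q : Block X → Set} {xs : List X} → (∀ b → P b → Q b) → Grouping P xs → Grouping Q xs
grouping-mono g (bs , u , l) =
  map (λ p → proj₁ p , g (proj₁ p) (proj₂ p)) bs ,
  subst (_↭ _) (sym (unblock-map g bs)) u ,
  subst (λ m → _ ≤ m + m) (sym (length-map _ bs)) l

grouping-singletons : {Q : Block X → Set} (xs : List X) → All (λ x → Q (inj₁ x)) xs → Grouping Q xs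
grouping-singletons []       []       = [] , ↭-refl , z≤n
grouping-singletons (x ∷ xs) (q ∷ qs) with grouping-singletons xs qs
... | bs , u , l = (inj₁ x , q) ∷ bs , prep x u ,
  s≤s (NP.≤-trans l (NP.+-monoʳ-≤ (length bs) (NP.n≤1+n _)))

grouping-pair : {Q : Block X → Set} {xs r : List X} (z w : X) →
  Q (inj₂ (z , w)) → xs ↭ z ∷ w ∷ r → Grouping Q r → Grouping Q xs
grouping-pair {r = r} z w q p (bs , u , l) =
  grouping-↭ p ((inj₂ (z , w) , q) ∷ bs , prep z (prep w u) ,
    s≤s (subst (suc (length r) ≤_) (sym (NP.+-suc (length bs) (length bs))) (s≤s l)))

shorter : {xs r : List X} {z w : X} (n : ℕ) → xs ↭ z ∷ w ∷ r → length xs ≤ suc n → length r ≤ n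
shorter n p l = NP.≤-trans (NP.n≤1+n _) (NP.≤-pred (subst (_≤ suc n) (PermP.↭-length p) l))

Small : (X → ℤ) → ℕ → Block X → Set
Small f a b = ∣ blockSum f b ∣ ≤ a

blockSum-neg : (f : X → ℤ) (b : Block X) → blockSum (λ x → - f x) b ≡ - blockSum f b
blockSum-neg f (inj₁ x)       = refl
blockSum-neg f (inj₂ (x , y)) = sym (ZP.neg-distrib-+ (f x) (f y))

small-neg : (f : X → ℤ) (a : ℕ) (b : Block X) → Small (λ x → - f x) a b → Small f a b
small-neg f a b = subst (_≤ a) (trans (cong ∣_∣ (blockSum-neg f b)) (ZP.∣-i∣≡∣i∣ (blockSum f b)))

sumℤ-pair : (f : X → ℤ) {xs r : List X} {z w : X} → xs ↭ z ∷ w ∷ r →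
  sumℤ f xs ≡ (f z +ℤ f w) +ℤ sumℤ f r
sumℤ-pair f {z = z} {w} p = trans (sumℤ-↭ f p) (sym (ZP.+-assoc (f z) (f w) _))

strictly-inside : ∀ a v → ∣ v ∣ ≤ suc a → v ≢ +[1+ a ] → v ≢ -[1+ a ] → ∣ v ∣ ≤ a
strictly-inside a (+ k)    b ≢max ≢min = NP.≤-pred (NP.≤∧≢⇒< b (λ e → ≢max (cong +_ e)))
strictly-inside a -[1+ k ] b ≢max ≢min =
  NP.≤-pred (NP.≤∧≢⇒< b (λ e → ≢min (cong -[1+_] (NP.suc-injective e))))

raise-negative : ∀ a v → v <ℤ 0ℤ → v ≢ -[1+ a ] → ∣ v ∣ ≤ suc a →
  Σ ℕ λ t → (+[1+ a ] +ℤ v ≡ + t) × t ≤ a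
raise-negative a (+ k)    (ℤ.+<+ ()) _ _
raise-negative a -[1+ k ] _ ≢min b =
  a ∸ k , trans (ZP.[1+m]⊖[1+n]≡m⊖n a k) (ZP.⊖-≥ k≤a) , NP.m∸n≤m a k
  where k≤a : k ≤ a
        k≤a = NP.<⇒≤ (NP.≤∧≢⇒< (NP.≤-pred b) (λ e → ≢min (cong -[1+_] e)))

total-positive : ∀ a s → 0ℤ ≤ℤ s → ¬ (+[1+ a ] +ℤ s ≤ℤ 0ℤ)
total-positive a (+ t) _ (ℤ.+≤+ ())

nonneg-rest : ∀ p s → 0ℤ ≤ℤ p → p +ℤ s ≤ℤ 0ℤ → s ≤ℤ 0ℤ
nonneg-rest p s 0≤p le = ZP.≤-trans (subst (_≤ℤ p +ℤ s) (ZP.+-identityˡ s) (ZP.+-monoˡ-≤ s 0≤p)) le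

-- One-sided halving: if no value is -(a+1) and the total is ≤ 0, then each
-- value a+1 can be paired with a negative value (the pair sums into [1, a]),
-- and all remaining values are small on their own.
pair-with-negatives : (f : X → ℤ) (a : ℕ) → (∀ x → ∣ f x ∣ ≤ suc a) →
  ∀ n (xs : List X) → length xs ≤ n → All (λ x → f x ≢ -[1+ a ]) xs → sumℤ f xs ≤ℤ 0ℤ →
  Grouping (Small f a) xs
pair-with-negatives f a bnd zero [] _ _ _ = [] , ↭-refl , z≤n
pair-with-negatives f a bnd (suc n) xs len noMin sum≤0 with extract (λ x → f x ℤ.≟ +[1+ a ]) xs
... | inj₂ noMax = grouping-singletons xs
        (All.zipWith (λ { {x} (≢max , ≢min) → strictly-inside a (f x) (bnd x) ≢max ≢min }) (noMax , noMin))
... | inj₁ (z , r , fz≡max , xs↭) with extract (λ x → f x ZP.<? 0ℤ) r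
...   | inj₂ nonneg = ⊥-elim (total-positive a (sumℤ f r)
          (sumℤ-nonneg f r (All.map ZP.≮⇒≥ nonneg))
          (subst (_≤ℤ 0ℤ) (trans (sumℤ-↭ f xs↭) (cong (_+ℤ sumℤ f r) fz≡max)) sum≤0))
...   | inj₁ (w , r' , fw<0 , r↭) = grouping-pair z w small p
          (pair-with-negatives f a bnd n r' (shorter n p len) (All.tail (All.tail noMin′)) rest≤0)
  where
    p : xs ↭ z ∷ w ∷ r'
    p = ↭-trans xs↭ (prep z r↭)
    noMin′ : All (λ x → f x ≢ -[1+ a ]) (z ∷ w ∷ r')
    noMin′ = PermP.All-resp-↭ p noMin
    raised : Σ ℕ λ t → (+[1+ a ] +ℤ f w ≡ + t) × t ≤ a
    raised = raise-negative a (f w) fw<0 (All.head (All.tail noMin′)) (bnd w)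
    pairSum : f z +ℤ f w ≡ + proj₁ raised
    pairSum = trans (cong (_+ℤ f w) fz≡max) (proj₁ (proj₂ raised))
    small : ∣ f z +ℤ f w ∣ ≤ a
    small = subst (_≤ a) (cong ∣_∣ (sym pairSum)) (proj₂ (proj₂ raised))
    rest≤0 : sumℤ f r' ≤ℤ 0ℤ
    rest≤0 = nonneg-rest (+ proj₁ raised) (sumℤ f r') (ℤ.+≤+ z≤n)
      (subst (_≤ℤ 0ℤ) (trans (sumℤ-pair f p) (cong (_+ℤ sumℤ f r') pairSum)) sum≤0)

-- Halving with fuel n: first cancel pairs of values a+1 and -(a+1); once one
-- of the two extreme values is absent, the one-sided version applies (to f
-- or to -f).
halve : (f : X → ℤ) (a : ℕ) → (∀ x → ∣ f x ∣ ≤ suc a) →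
  ∀ n (xs : List X) → length xs ≤ n → sumℤ f xs ≡ 0ℤ → Grouping (Small f a) xs
halve f a bnd zero [] _ _ = [] , ↭-refl , z≤n
halve f a bnd (suc n) xs len sum0 with extract (λ x → f x ℤ.≟ +[1+ a ]) xs
... | inj₂ noMax = grouping-mono (small-neg f a)
        (pair-with-negatives (λ x → - f x) a bnd′ (suc n) xs len
          (All.map (λ {x} ≢max e → ≢max (trans (sym (ZP.neg-involutive (f x))) (cong -_ e))) noMax)
          (ZP.≤-reflexive (trans (sumℤ-neg f xs) (cong -_ sum0))))
  where bnd′ : ∀ x → ∣ - f x ∣ ≤ suc a
        bnd′ x = subst (_≤ suc a) (sym (ZP.∣-i∣≡∣i∣ (f x))) (bnd x)
... | inj₁ (z , r , fz≡max , xs↭) with extract (λ x → f x ℤ.≟ -[1+ a ]) r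
...   | inj₂ noMin = pair-with-negatives f a bnd (suc n) xs len
          (PermP.All-resp-↭ (↭-sym xs↭) ((λ e → max≢min (trans (sym fz≡max) e)) ∷ noMin))
          (ZP.≤-reflexive sum0)
  where max≢min : +[1+ a ] ≢ -[1+ a ]
        max≢min ()
...   | inj₁ (w , r' , fw≡min , r↭) = grouping-pair z w (subst (λ v → ∣ v ∣ ≤ a) (sym cancel) z≤n) p
          (halve f a bnd n r' (shorter n p len) rest0)
  where
    p : xs ↭ z ∷ w ∷ r'
    p = ↭-trans xs↭ (prep z r↭)
    cancel : f z +ℤ f w ≡ 0ℤ
    cancel = trans (cong₂ _+ℤ_ fz≡max fw≡min) (ZP.+-inverseʳ +[1+ a ])
    rest0 : sumℤ f r' ≡ 0ℤ
    rest0 = trans (sym (ZP.+-identityˡ _)) (trans (cong (_+ℤ sumℤ f r') (sym cancel))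
              (trans (sym (sumℤ-pair f p)) sum0))

halving : (f : X → ℤ) (a : ℕ) → (∀ x → ∣ f x ∣ ≤ suc a) →
  (xs : List X) → sumℤ f xs ≡ 0ℤ → Grouping (Small f a) xs
halving f a bnd xs = halve f a bnd (length xs) xs NP.≤-refl

ZeroSum : {d : ℕ} → (Fin d → X → ℤ) → List X → Set
ZeroSum F xs = ∀ ι → sumℤ (F ι) xs ≡ 0ℤ

-- xs rearranges into two nonempty parts, the first of sum zero (so that
-- the second has sum zero too whenever xs does).
ZeroSumSplit : {d : ℕ} → (Fin d → X → ℤ) → List X → Set
ZeroSumSplit {X} F xs = Σ (List X) λ ys → Σ (List X) λ zs →
  (xs ↭ ys ++ zs) × (1 ≤ length ys) × (1 ≤ length zs) × ZeroSum F ys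

Threshold : {d : ℕ} → (Fin d → X → ℤ) → Set
Threshold {X} F = Σ ℕ λ G → ∀ (xs : List X) → ZeroSum F xs → G ≤ length xs → ZeroSumSplit F xs

Splittable : ℕ → Set₁
Splittable d = ∀ {X : Set} (F : Fin d → X → ℤ) (a : ℕ) → (∀ ι x → ∣ F ι x ∣ ≤ a) → Threshold F

blockwise : {d : ℕ} {Q : Block X → Set} → (Fin d → X → ℤ) → Fin d → Σ (Block X) Q → ℤ
blockwise F ι p = blockSum (F ι) (proj₁ p)

block-bound : (g : X → ℤ) (a : ℕ) → (∀ x → ∣ g x ∣ ≤ a) → ∀ b → ∣ blockSum g b ∣ ≤ a + a
block-bound g a h (inj₁ x)       = NP.≤-trans (h x) (NP.m≤m+n a a)
block-bound g a h (inj₂ (x , y)) = NP.≤-trans (ZP.∣i+j∣≤∣i∣+∣j∣ (g x) (g y)) (NP.+-mono-≤ (h x) (h y))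

zeroSum-blocks : {d : ℕ} {Q : Block X → Set} (F : Fin d → X → ℤ) {xs : List X}
  (bs : List (Σ (Block X) Q)) → unblock bs ↭ xs → ZeroSum F xs → ZeroSum (blockwise F) bs
zeroSum-blocks F bs u zs ι = trans (sym (sumℤ-unblock (F ι) bs)) (trans (sumℤ-↭ (F ι) u) (zs ι))

split-unblock : {d : ℕ} {Q : Block X → Set} (F : Fin d → X → ℤ) {xs : List X}
  (bs : List (Σ (Block X) Q)) → unblock bs ↭ xs → ZeroSumSplit (blockwise F) bs → ZeroSumSplit F xs
split-unblock F bs u (B₁ , B₂ , q , l₁ , l₂ , z) =
  unblock B₁ , unblock B₂ ,
  ↭-trans (↭-sym u) (subst (unblock bs ↭_) (unblock-++ B₁ B₂) (unblock-↭ q)) ,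
  NP.≤-trans l₁ (length-unblock B₁) , NP.≤-trans l₂ (length-unblock B₂) ,
  λ ι → trans (sumℤ-unblock (F ι) B₁) (z ι)

half-≤ : ∀ G l b → G + G ≤ l → l ≤ b + b → G ≤ b
half-≤ G l b h₁ h₂ = NP.≮⇒≥ (λ b<G → NP.<⇒≱ (NP.+-mono-< b<G b<G) (NP.≤-trans h₁ h₂))

splittable-zero : Splittable 0
splittable-zero F a _ = 2 , split
  where split : ∀ xs → ZeroSum F xs → 2 ≤ length xs → ZeroSumSplit F xs
        split (x ∷ y ∷ r) _ _         = x ∷ [] , y ∷ r , ↭-refl , s≤s z≤n , s≤s z≤n , λ ()
        split (x ∷ [])    _ (s≤s ())

-- Dimension d+1 from dimension d, by induction on the bound a₀ of the first
-- coordinate.  For a₀ = 0 that coordinate vanishes; for a₀+1, halving the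
-- first coordinate yields a list of blocks with first coordinate bounded by
-- a₀ (the others by a+a) and at least half as many entries.
splittable-suc : ∀ d → Splittable d → ∀ a₀ {X : Set} (F : Fin (suc d) → X → ℤ) (a : ℕ) →
  (∀ x → ∣ F fz x ∣ ≤ a₀) → (∀ ι x → ∣ F (fs ι) x ∣ ≤ a) → Threshold F
splittable-suc d splittable-d zero F a b₀ b with splittable-d (λ ι → F (fs ι)) a b
... | G , split = G , λ xs zs l → with-first (split xs (λ ι → zs (fs ι)) l)
  where
    with-first : ∀ {xs} → ZeroSumSplit (λ ι → F (fs ι)) xs → ZeroSumSplit F xs
    with-first (ys , zs , p , l₁ , l₂ , z) = ys , zs , p , l₁ , l₂ , λ
      { fz → sumℤ-zero (F fz) ys (λ x → ZP.∣i∣≡0⇒i≡0 (NP.n≤0⇒n≡0 (b₀ x)))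
      ; (fs ι) → z ι }
splittable-suc d splittable-d (suc a₀) F a b₀ b
  with splittable-suc d splittable-d a₀ (blockwise F) (a + a) proj₂
         (λ ι p → block-bound (F (fs ι)) a (b ι) (proj₁ p))
... | G , splitBlocks = G + G , split
  where
    split : ∀ xs → ZeroSum F xs → G + G ≤ length xs → ZeroSumSplit F xs
    split xs zs l with halving (F fz) a₀ b₀ xs (zs fz)
    ... | bs , u , l′ = split-unblock F bs u
            (splitBlocks bs (zeroSum-blocks F bs u zs) (half-≤ G (length xs) (length bs) l l′))

splittable : ∀ d → Splittable d
splittable zero    = splittable-zero
splittable (suc d) F a bnd = splittable-suc d (splittable d) a F a (bnd fz) (λ ι → bnd (fs ι))

sumFin-cong : ∀ m {f g : Fin m → ℕ} → (∀ i → f i ≡ g i) → sumFin m f ≡ sumFin m g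
sumFin-cong zero    h = refl
sumFin-cong (suc m) h = cong₂ _+_ (h fz) (sumFin-cong m (λ i → h (fs i)))

sumFin-0 : ∀ m → sumFin m (λ _ → 0) ≡ 0
sumFin-0 zero    = refl
sumFin-0 (suc m) = sumFin-0 m

sumFin-+ : ∀ m (f g : Fin m → ℕ) → sumFin m (λ i → f i + g i) ≡ sumFin m f + sumFin m g
sumFin-+ zero    f g = refl
sumFin-+ (suc m) f g = trans (cong (_+_ (f fz + g fz)) (sumFin-+ m (λ i → f (fs i)) (λ i → g (fs i))))
  (CSP.interchange NP.+-commutativeSemigroup (f fz) (g fz) _ _)

sumFin-*ˡ : ∀ m c (f : Fin m → ℕ) → sumFin m (λ i → c * f i) ≡ c * sumFin m f
sumFin-*ˡ zero    c f = sym (NP.*-zeroʳ c)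
sumFin-*ˡ (suc m) c f = trans (cong (_+_ (c * f fz)) (sumFin-*ˡ m c (λ i → f (fs i))))
  (sym (NP.*-distribˡ-+ c (f fz) _))

δ : ∀ {m} → Fin m → Fin m → ℕ
δ fz     fz     = 1
δ fz     (fs _) = 0
δ (fs _) fz     = 0
δ (fs i) (fs j) = δ i j

δ-refl : ∀ {m} (i : Fin m) → δ i i ≡ 1
δ-refl fz     = refl
δ-refl (fs i) = δ-refl i

δ≤1 : ∀ {m} (i j : Fin m) → δ i j ≤ 1
δ≤1 fz     fz     = s≤s z≤n
δ≤1 fz     (fs _) = z≤n
δ≤1 (fs _) fz     = z≤n
δ≤1 (fs i) (fs j) = δ≤1 i j

δ*δ≤1 : ∀ {m} (a b c d : Fin m) → δ a b * δ c d ≤ 1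
δ*δ≤1 a b c d = NP.*-mono-≤ (δ≤1 a b) (δ≤1 c d)

sumFin-select : ∀ m (g : Fin m → ℕ) (i : Fin m) → sumFin m (λ a → δ a i * g a) ≡ g i
sumFin-select (suc m) g fz     = trans (cong₂ _+_ (NP.+-identityʳ (g fz)) (sumFin-0 m)) (NP.+-identityʳ (g fz))
sumFin-select (suc m) g (fs i) = sumFin-select m (λ a → g (fs a)) i

sumFin-δ : ∀ m (i : Fin m) → sumFin m (λ j → δ i j) ≡ 1
sumFin-δ (suc m) fz     = cong suc (sumFin-0 m)
sumFin-δ (suc m) (fs i) = sumFin-δ m i

sumℕ : (X → ℕ) → List X → ℕ
sumℕ h xs = sum (map h xs)

sumℕ-split : (h : X → ℕ) {xs ys zs : List X} → xs ↭ ys ++ zs → sumℕ h xs ≡ sumℕ h ys + sumℕ h zs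
sumℕ-split h {ys = ys} {zs} p =
  trans (sum-↭ (PermP.map⁺ h p)) (trans (cong sum (map-++ h ys zs)) (sum-++ (map h ys) (map h zs)))

sumℕ-≤-length : (h : X → ℕ) → (∀ x → h x ≤ 1) → (ys : List X) → sumℕ h ys ≤ length ys
sumℕ-≤-length h h≤1 []       = z≤n
sumℕ-≤-length h h≤1 (y ∷ ys) = NP.+-mono-≤ (h≤1 y) (sumℕ-≤-length h h≤1 ys)

sumℕ-replicate : (h : X → ℕ) (k : ℕ) (x : X) → sumℕ h (replicate k x) ≡ k * h x
sumℕ-replicate h zero    x = refl
sumℕ-replicate h (suc k) x = cong (_+_ (h x)) (sumℕ-replicate h k x)

sumℕ-concat : (h : X → ℕ) (m : ℕ) (g : Fin m → List X) →
  sumℕ h (concat (tabulate g)) ≡ sumFin m (λ a → sumℕ h (g a))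
sumℕ-concat h zero    g = refl
sumℕ-concat h (suc m) g =
  trans (sumℕ-split h {ys = g fz} ↭-refl) (cong (_+_ (sumℕ h (g fz))) (sumℕ-concat h m (λ a → g (fs a))))

Entry : ℕ → Set
Entry n = Fin n × Fin n × Fin n

at : ∀ {n} → Entry n → Array n
at (a , b , c) i j s = δ a i * (δ b j * δ c s)

toArray : ∀ {n} → List (Entry n) → Array n
toArray ys i j s = sumℕ (λ t → at t i j s) ys

expand : ∀ {n} → Array n → List (Entry n)
expand L = concat (tabulate λ a → concat (tabulate λ b → concat (tabulate λ c → replicate (L a b c) (a , b , c))))

toArray-expand : ∀ {n} (L : Array n) i j s → toArray (expand L) i j s ≡ L i j s
toArray-expand {n} L i j s = begin
  toArray (expand L) i j s
    ≡⟨ trans (sumℕ-concat entry n _) (sumFin-cong n λ a →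
       trans (sumℕ-concat entry n _) (sumFin-cong n λ b →
       trans (sumℕ-concat entry n _) (sumFin-cong n λ c →
       sumℕ-replicate entry (L a b c) (a , b , c)))) ⟩
  sumFin n (λ a → sumFin n λ b → sumFin n λ c → L a b c * (δ a i * (δ b j * δ c s)))
    ≡⟨ sumFin-cong n (λ a → sumFin-cong n (λ b → select-symbol a b)) ⟩
  sumFin n (λ a → sumFin n λ b → δ a i * (δ b j * L a b s))
    ≡⟨ sumFin-cong n (λ a → trans (sumFin-*ˡ n (δ a i) _) (cong (δ a i *_) (sumFin-select n (λ b → L a b s) j))) ⟩
  sumFin n (λ a → δ a i * L a j s)
    ≡⟨ sumFin-select n (λ a → L a j s) i ⟩
  L i j s ∎
  where
    open ≡-Reasoning
    entry : Entry n → ℕ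
    entry t = at t i j s
    rearrange : ∀ x p q r → x * (p * (q * r)) ≡ p * (q * (r * x))
    rearrange = solve 4 (λ x p q r → x :* (p :* (q :* r)) := p :* (q :* (r :* x))) refl
      where open import Data.Nat.Solver using (module +-*-Solver)
            open +-*-Solver
    select-symbol : ∀ a b → sumFin n (λ c → L a b c * (δ a i * (δ b j * δ c s))) ≡ δ a i * (δ b j * L a b s)
    select-symbol a b =
      trans (sumFin-cong n (λ c → rearrange (L a b c) (δ a i) (δ b j) (δ c s)))
      (trans (sumFin-*ˡ n (δ a i) _) (cong (δ a i *_)
      (trans (sumFin-*ˡ n (δ b j) _) (cong (δ b j *_) (sumFin-select n (L a b) s)))))

Line : ℕ → Set
Line n = Fin 3 × Fin n × Fin n

lineSum : ∀ {n} → Line n → Array n → ℕ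
lineSum {n} (fz , i , s)         M = sumFin n (λ j → M i j s)
lineSum {n} (fs fz , j , s)      M = sumFin n (λ i → M i j s)
lineSum {n} (fs (fs fz) , i , j) M = sumFin n (λ s → M i j s)

onLine : ∀ {n} → Line n → Entry n → ℕ
onLine (fz , i , s)         (a , b , c) = δ a i * δ c s
onLine (fs fz , j , s)      (a , b , c) = δ b j * δ c s
onLine (fs (fs fz) , i , j) (a , b , c) = δ a i * δ b j

onLine≤1 : ∀ {n} (ℓ : Line n) t → onLine ℓ t ≤ 1
onLine≤1 (fz , i , s)         (a , b , c) = δ*δ≤1 a i c s
onLine≤1 (fs fz , j , s)      (a , b , c) = δ*δ≤1 b j c s
onLine≤1 (fs (fs fz) , i , j) (a , b , c) = δ*δ≤1 a i b j

latin⇒lineSum : ∀ {n k} {M : Array n} → IsKLatin n k M → ∀ ℓ → lineSum ℓ M ≡ k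
latin⇒lineSum lat (fz , i , s)         = IsKLatin.row-count lat i s
latin⇒lineSum lat (fs fz , j , s)      = IsKLatin.col-count lat j s
latin⇒lineSum lat (fs (fs fz) , i , j) = IsKLatin.cell-size lat i j

lineSum⇒latin : ∀ {n k} {M : Array n} → (∀ ℓ → lineSum ℓ M ≡ k) → IsKLatin n k M
lineSum⇒latin h = record
  { cell-size = λ i j → h (fs (fs fz) , i , j)
  ; row-count = λ i s → h (fz , i , s)
  ; col-count = λ j s → h (fs fz , j , s) }

lineSum-cong : ∀ {n} (ℓ : Line n) {M M′ : Array n} → (∀ i j s → M i j s ≡ M′ i j s) → lineSum ℓ M ≡ lineSum ℓ M′
lineSum-cong {n} (fz , i , s)         e = sumFin-cong n (λ j → e i j s)
lineSum-cong {n} (fs fz , j , s)      e = sumFin-cong n (λ i → e i j s)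
lineSum-cong {n} (fs (fs fz) , i , j) e = sumFin-cong n (λ s → e i j s)

lineSum-+ : ∀ {n} (ℓ : Line n) (M M′ : Array n) →
  lineSum ℓ (λ i j s → M i j s + M′ i j s) ≡ lineSum ℓ M + lineSum ℓ M′
lineSum-+ {n} (fz , i , s)         M M′ = sumFin-+ n _ _
lineSum-+ {n} (fs fz , j , s)      M M′ = sumFin-+ n _ _
lineSum-+ {n} (fs (fs fz) , i , j) M M′ = sumFin-+ n _ _

lineSum-0 : ∀ {n} (ℓ : Line n) → lineSum ℓ (λ _ _ _ → 0) ≡ 0
lineSum-0 {n} (fz , _ , _)         = sumFin-0 n
lineSum-0 {n} (fs fz , _ , _)      = sumFin-0 n
lineSum-0 {n} (fs (fs fz) , _ , _) = sumFin-0 n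

lineSum-at : ∀ {n} (ℓ : Line n) (t : Entry n) → lineSum ℓ (at t) ≡ onLine ℓ t
lineSum-at {n} (fz , i , s) (a , b , c) =
  trans (sumFin-*ˡ n (δ a i) _) (cong (δ a i *_)
    (trans (sumFin-cong n (λ j → NP.*-comm (δ b j) (δ c s)))
    (trans (sumFin-*ˡ n (δ c s) _) (trans (cong (δ c s *_) (sumFin-δ n b)) (NP.*-identityʳ (δ c s))))))
lineSum-at {n} (fs fz , j , s) (a , b , c) =
  trans (sumFin-cong n (λ i → NP.*-comm (δ a i) _))
    (trans (sumFin-*ˡ n (δ b j * δ c s) (δ a)) (trans (cong ((δ b j * δ c s) *_) (sumFin-δ n a)) (NP.*-identityʳ _)))
lineSum-at {n} (fs (fs fz) , i , j) (a , b , c) =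
  trans (sumFin-*ˡ n (δ a i) _) (cong (δ a i *_)
    (trans (sumFin-*ˡ n (δ b j) _) (trans (cong (δ b j *_) (sumFin-δ n c)) (NP.*-identityʳ (δ b j)))))

lineCount : ∀ {n} → Line n → List (Entry n) → ℕ
lineCount ℓ = sumℕ (onLine ℓ)

lineSum-toArray : ∀ {n} (ℓ : Line n) (ys : List (Entry n)) → lineSum ℓ (toArray ys) ≡ lineCount ℓ ys
lineSum-toArray ℓ []       = lineSum-0 ℓ
lineSum-toArray ℓ (t ∷ ys) =
  trans (lineSum-+ ℓ (at t) (toArray ys)) (cong₂ _+_ (lineSum-at ℓ t) (lineSum-toArray ℓ ys))

Balanced : ∀ {n} → ℕ → List (Entry n) → Set
Balanced {n} m ys = (ℓ : Line n) → lineCount ℓ ys ≡ m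

balanced⇒latin : ∀ {n m} (ys : List (Entry n)) → Balanced m ys → IsKLatin n m (toArray ys)
balanced⇒latin ys bal = lineSum⇒latin (λ ℓ → trans (lineSum-toArray ℓ ys) (bal ℓ))

balanced-expand : ∀ {n k} (L : Array n) → IsKLatin n k L → Balanced k (expand L)
balanced-expand L lat ℓ =
  trans (sym (lineSum-toArray ℓ (expand L))) (trans (lineSum-cong ℓ (toArray-expand L)) (latin⇒lineSum lat ℓ))

-- Each entry meets a line at most once, so a balanced list is long.
balanced-length : ∀ {n m} (ℓ : Line n) (ys : List (Entry n)) → Balanced m ys → m ≤ length ys
balanced-length ℓ ys bal = subst (_≤ length ys) (bal ℓ) (sumℕ-≤-length (onLine ℓ) (onLine≤1 ℓ) ys)

-- A nonempty balanced list has positive value: its first entry meets its own cell.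
balanced-pos : ∀ {n m} (ys : List (Entry n)) → Balanced m ys → 1 ≤ length ys → 0 < m
balanced-pos ((a , b , c) ∷ ys) bal _ =
  subst (1 ≤_) (bal (fs (fs fz) , a , b))
    (NP.≤-trans (NP.≤-reflexive (sym (cong₂ _*_ (δ-refl a) (δ-refl b)))) (NP.m≤m+n _ _))

balanced-complement : ∀ {n k m} {xs ys zs : List (Entry n)} →
  xs ↭ ys ++ zs → Balanced k xs → Balanced m ys → Balanced (k ∸ m) zs
balanced-complement {k = k} {m} {xs} {ys} {zs} p balX balY ℓ = begin
  lineCount ℓ zs            ≡⟨ sym (NP.m+n∸m≡n m _) ⟩
  m + lineCount ℓ zs ∸ m    ≡⟨ cong (λ v → v + lineCount ℓ zs ∸ m) (sym (balY ℓ)) ⟩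
  lineCount ℓ ys + lineCount ℓ zs ∸ m  ≡⟨ cong (_∸ m) (trans (sym (sumℕ-split (onLine ℓ) {ys = ys} {zs} p)) (balX ℓ)) ⟩
  k ∸ m                     ∎
  where open ≡-Reasoning

kindAndCell : ∀ {n} → Fin 3 × Fin (n * n) → Line n
kindAndCell {n} (kind , c) = kind , remQuot n c

lineAt : ∀ {n} → Fin (3 * (n * n)) → Line n
lineAt {n} ι = kindAndCell (remQuot {3} (n * n) ι)

lineAt-combine : ∀ {n} (kind : Fin 3) (u v : Fin n) → lineAt (combine kind (combine u v)) ≡ (kind , u , v)
lineAt-combine {n} kind u v =
  trans (cong kindAndCell (remQuot-combine kind (combine u v))) (cong (kind ,_) (remQuot-combine {n} u v))

excess : ∀ {n} → Line n → Fin (3 * (n * n)) → Entry n → ℤ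
excess ℓ₀ ι t = + onLine (lineAt ι) t - + onLine ℓ₀ t

excess-bound : ∀ {n} (ℓ₀ : Line n) ι t → ∣ excess ℓ₀ ι t ∣ ≤ 2
excess-bound ℓ₀ ι t = NP.≤-trans (ZP.∣i-j∣≤∣i∣+∣j∣ (+ onLine (lineAt ι) t) (+ onLine ℓ₀ t))
  (NP.+-mono-≤ (onLine≤1 (lineAt ι) t) (onLine≤1 ℓ₀ t))

sumℤ-difference : (h h′ : X → ℕ) (ys : List X) →
  sumℤ (λ x → + h x - + h′ x) ys ≡ + sumℕ h ys - + sumℕ h′ ys
sumℤ-difference h h′ [] = refl
sumℤ-difference h h′ (y ∷ ys) = begin
  (+ h y - + h′ y) +ℤ sumℤ (λ x → + h x - + h′ x) ys
    ≡⟨ cong ((+ h y - + h′ y) +ℤ_) (sumℤ-difference h h′ ys) ⟩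
  (+ h y - + h′ y) +ℤ (+ sumℕ h ys - + sumℕ h′ ys)
    ≡⟨ CSP.interchange ZP.+-commutativeSemigroup (+ h y) (- + h′ y) (+ sumℕ h ys) (- + sumℕ h′ ys) ⟩
  (+ h y +ℤ + sumℕ h ys) +ℤ (- + h′ y +ℤ - + sumℕ h′ ys)
    ≡⟨ cong₂ _+ℤ_ (sym (ZP.pos-+ (h y) _)) (sym (ZP.neg-distrib-+ (+ h′ y) _)) ⟩
  + (h y + sumℕ h ys) +ℤ - (+ h′ y +ℤ + sumℕ h′ ys)
    ≡⟨ cong (λ v → + (h y + sumℕ h ys) - v) (sym (ZP.pos-+ (h′ y) _)) ⟩
  + (h y + sumℕ h ys) - + (h′ y + sumℕ h′ ys) ∎
  where open ≡-Reasoning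

balanced⇒zeroSum : ∀ {n m} (ℓ₀ : Line n) (ys : List (Entry n)) → Balanced m ys → ZeroSum (excess ℓ₀) ys
balanced⇒zeroSum {m = m} ℓ₀ ys bal ι =
  trans (sumℤ-difference (onLine (lineAt ι)) (onLine ℓ₀) ys)
    (trans (cong₂ (λ p q → + p - + q) (bal (lineAt ι)) (bal ℓ₀)) (ZP.+-inverseʳ (+ m)))

zeroSum⇒balanced : ∀ {n} (ℓ₀ : Line n) (ys : List (Entry n)) → ZeroSum (excess ℓ₀) ys → Balanced (lineCount ℓ₀ ys) ys
zeroSum⇒balanced ℓ₀ ys zs (kind , u , v) = ZP.+-injective (ZP.i-j≡0⇒i≡j _ _
  (trans (sym (sumℤ-difference (onLine (kind , u , v)) (onLine ℓ₀) ys))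
    (subst (λ ℓ → sumℤ (λ t → + onLine ℓ t - + onLine ℓ₀ t) ys ≡ 0ℤ)
      (lineAt-combine kind u v) (zs (combine kind (combine u v))))))

separable-from-split : ∀ {n k} (ℓ₀ : Line n) (L : Array n) → IsKLatin n k L →
  ZeroSumSplit (excess ℓ₀) (expand L) → Separable n k L
separable-from-split {n} {k} ℓ₀ L lat (ys , zs , p , ys≢[] , zs≢[] , zeroY) =
  m , k ∸ m , toArray ys , toArray zs ,
  balanced-pos ys balY ys≢[] , balanced-pos zs balZ zs≢[] , NP.m+[n∸m]≡n m≤k ,
  balanced⇒latin ys balY , balanced⇒latin zs balZ ,
  λ i j s → trans (sym (toArray-expand L i j s)) (sumℕ-split (λ t → at t i j s) {ys = ys} {zs} p)
  where
    m : ℕ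
    m = lineCount ℓ₀ ys
    balX : Balanced k (expand L)
    balX = balanced-expand L lat
    balY : Balanced m ys
    balY = zeroSum⇒balanced ℓ₀ ys zeroY
    balZ : Balanced (k ∸ m) zs
    balZ = balanced-complement {ys = ys} {zs} p balX balY
    m≤k : m ≤ k
    m≤k = subst (m ≤_) (trans (sym (sumℕ-split (onLine ℓ₀) {ys = ys} {zs} p)) (balX ℓ₀)) (NP.m≤m+n m _)

ℓ₀ : ∀ {n} → Line (suc n)
ℓ₀ = fz , fz , fz

mainTheorem3 : (n : ℕ) → 0 < n → Σ ℕ λ g → (k : ℕ) → k ≥ g →
    (L : Array n) → IsKLatin n k L → Separable n k L
mainTheorem3 zero ()
mainTheorem3 (suc n) _ = proj₁ threshold , separable
  where
    threshold : Threshold (excess ℓ₀)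
    threshold = splittable (3 * (suc n * suc n)) (excess ℓ₀) 2 (excess-bound ℓ₀)
    separable : (k : ℕ) → k ≥ proj₁ threshold → (L : Array (suc n)) → IsKLatin (suc n) k L → Separable (suc n) k L
    separable k k≥G L lat = separable-from-split ℓ₀ L lat
      (proj₂ threshold (expand L) (balanced⇒zeroSum ℓ₀ (expand L) balanced)
        (NP.≤-trans k≥G (balanced-length ℓ₀ (expand L) balanced)))
      where
        balanced : Balanced k (expand L)
        balanced = balanced-expand L lat
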